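{- Let $G$ be a connected graph with $n$ vertices and let $t\ge1$ be an integer. Then \[ \tau_t(G)\ge tn-\sum_{\{u,v\}}\big(d(u,v)-1\big), \] where the sum is over all unordered pairs of distinct vertices $u,v\in V(G)$. Furthermore, if $G$ has diameter $D$ and $t\ge (n-1)(D-1)$, then equality holds.
   Context: $d(u,v)$ is graph distance in $G$. A $t$-tone coloring of $G$ assigns to each vertex $v$ a set $f(v)$ of exactly $t$ colors from a color set $C$ such that $|f(u)\cap f(v)|<d(u,v)$ for all distinct $u,v$; $\tau_t(G)$ is the minimum $|C|$ over all such colorings. -}

module Defs where

open import Data.Nat using (ℕ; zero; suc; _+_; _*_; _∸_; _≤_; _<_)
open import Data.Fin using (Fin; toℕ)
open import Data.Fin.Subset using (Subset; _∩_; ∣_∣)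
open import Data.List using (List; map)
open import Data.Nat.ListAction using (sum)
open import Data.List using () renaming (allFin to allFinL)
open import Data.Product using (Σ; _×_; ∃; ∃-syntax)
open import Relation.Binary.PropositionalEquality using (_≡_)
open import Relation.Nullary using (¬_; yes; no)
open import Data.Nat using (_<?_)

record Graph (n : ℕ) : Set₁ where
  field
    Adj     : Fin n → Fin n → Set
    symAdj  : ∀ {u v} → Adj u v → Adj v u
    irrefl  : ∀ {u} → ¬ Adj u u

open Graph public

data Walk {n : ℕ} (G : Graph n) : Fin n → Fin n → ℕ → Set where
  here : ∀ {u} → Walk G u u 0
  step : ∀ {u w v k} → Adj G u w → Walk G w v k → Walk G u v (suc k)

Connected : ∀ {n} → Graph n → Set
Connected {n} G = ∀ (u v : Fin n) → ∃[ k ] Walk G u v k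

IsDistance : ∀ {n} → Graph n → (Fin n → Fin n → ℕ) → Set
IsDistance {n} G d = ∀ (u v : Fin n) → Walk G u v (d u v) × (∀ k → Walk G u v k → d u v ≤ k)

IsDiameter : ∀ {n} → (Fin n → Fin n → ℕ) → ℕ → Set
IsDiameter {n} d D = (∀ (u v : Fin n) → d u v ≤ D) × (∃[ u ] ∃[ v ] d u v ≡ D)

IsToneColoring : ∀ {n} → (Fin n → Fin n → ℕ) → (t k : ℕ) → (Fin n → Subset k) → Set
IsToneColoring {n} d t k f =
  (∀ v → ∣ f v ∣ ≡ t) × (∀ u v → ¬ (u ≡ v) → ∣ f u ∩ f v ∣ < d u v)

ToneColorable : ∀ {n} → (Fin n → Fin n → ℕ) → (t k : ℕ) → Set
ToneColorable {n} d t k = Σ (Fin n → Subset k) (IsToneColoring d t k)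

IsTau : ∀ {n} → (Fin n → Fin n → ℕ) → (t k : ℕ) → Set
IsTau d t k = ToneColorable d t k × (∀ k′ → ToneColorable d t k′ → k ≤ k′)

pairSum : ∀ {n} → (Fin n → Fin n → ℕ) → ℕ
pairSum {n} g = sum (map (λ u → sum (map (λ v → term u v) (allFinL n))) (allFinL n))
  where
  term : Fin n → Fin n → ℕ
  term u v with toℕ u <? toℕ v
  ... | yes _ = g u v
  ... | no _  = 0

-- A tone colouring f with k colours has ∑ᵥ |f v| = t n, and the Bonferroni inequality
-- ∑ᵥ |f v| ≤ |⋃ᵥ f v| + ∑_{u<v} |f u ∩ f v|, with |f u ∩ f v| ≤ d u v − 1, gives
-- t n ≤ k + ∑_{u<v} (d u v − 1).  Conversely, give every pair u < v a block of d u v − 1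
-- colours used by u and v only, and complete each vertex w with fresh colours: w lies in
-- blocks of total size ∑ᵥ (d w v − 1) ≤ (n − 1)(D − 1) ≤ t, and the number of colours is
-- ∑_{u<v} (d u v − 1) + (t n − 2 ∑_{u<v} (d u v − 1)), which meets the bound.  Tone
-- colourability with k colours is decidable by exhaustive search, so τ_t exists as the
-- least such k once some k works, e.g. with blocks of size 0.

module Submission where

open import Defs
open import Data.Bool using (Bool; true; false; T; if_then_else_; _∧_; _∨_)
open import Data.Empty using (⊥; ⊥-elim)
open import Data.Fin using (Fin; zero; suc; toℕ)
open import Data.Fin.Properties using (_≟_; all?; toℕ-injective)
open import Data.Fin.Subset using (Subset; _∩_; _∪_; ∣_∣; ⋃)
open import Data.Fin.Subset.Properties
  using (anySubset?; ∣p∣≤n; ∩-distribˡ-∪; ∩-zeroʳ; ∣⊥∣≡0; ∣⊤∣≡n)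
open import Data.List using (map; tabulate) renaming (allFin to allFinL)
open import Data.List.Properties using (map-cong; map-tabulate)
import Data.Nat.ListAction as List
open import Data.Nat using (ℕ; zero; suc; _+_; _*_; _∸_; _≤_; _<_; z≤n; s≤s; z<s)
open import Data.Nat.Properties hiding (_≟_)
import Data.Nat.Properties as ℕ
open import Data.Product using (∃; ∃-syntax; _×_; _,_; proj₁; proj₂)
open import Data.Sum using (inj₁; inj₂)
open import Data.Vec using ([]; _∷_; _++_; replicate)
open import Data.Vec.Properties using (zipWith-++; zipWith-replicate)
import Data.Vec.Functional as Vector
open import Function using (_∘_; id)
open import Relation.Binary using (tri<; tri≈; tri>)
open import Relation.Binary.PropositionalEquality
open import Relation.Nullary using (Dec; yes; no; does; ¬_; contradiction)
open import Relation.Nullary.Decidable using (dec-true; dec-false; map′; _×-dec_; _→-dec_; ¬?)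
open import Relation.Unary using (Decidable)
open import Algebra.Properties.CommutativeMonoid.Sum +-0-commutativeMonoid
  using (sum-syntax; ∑-distrib-+; ∑-comm; sum-cong-≗; sum-replicate-zero)

-- Finite sums

∑-mono-≤ : ∀ {n} {f g : Fin n → ℕ} → (∀ i → f i ≤ g i) → ∑[ i < n ] f i ≤ ∑[ i < n ] g i
∑-mono-≤ {zero}  f≤g = z≤n
∑-mono-≤ {suc n} f≤g = +-mono-≤ (f≤g zero) (∑-mono-≤ (f≤g ∘ suc))

∑-const : ∀ n c → ∑[ i < n ] c ≡ n * c
∑-const zero    c = refl
∑-const (suc n) c = cong (c +_) (∑-const n c)

∑-complement : ∀ {n} c (f : Fin n → ℕ) → (∀ i → f i ≤ c) →
               ∑[ i < n ] (c ∸ f i) + ∑[ i < n ] f i ≡ n * c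
∑-complement {n} c f f≤c = begin
  ∑[ i < n ] (c ∸ f i) + ∑[ i < n ] f i  ≡⟨ ∑-distrib-+ (λ i → c ∸ f i) f ⟨
  ∑[ i < n ] (c ∸ f i + f i)            ≡⟨ sum-cong-≗ (λ i → m∸n+n≡m (f≤c i)) ⟩
  ∑[ i < n ] c                          ≡⟨ ∑-const n c ⟩
  n * c                                 ∎
  where open ≡-Reasoning

∑-if : ∀ {n} b (f : Fin n → ℕ) →
       ∑[ i < n ] (if b then f i else 0) ≡ (if b then ∑[ i < n ] f i else 0)
∑-if     true  f = refl
∑-if {n} false f = sum-replicate-zero n

∑-if-≟ : ∀ {n} (w : Fin n) (f : Fin n → ℕ) → ∑[ i < n ] (if does (i ≟ w) then f i else 0) ≡ f w
∑-if-≟ {suc n} zero    f = trans (cong (f zero +_) (sum-replicate-zero n)) (+-identityʳ (f zero))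
∑-if-≟         (suc w) f = ∑-if-≟ w (f ∘ suc)

∑≤[n∸1]*c : ∀ {n} (w : Fin n) (f : Fin n → ℕ) {c} → f w ≡ 0 → (∀ i → f i ≤ c) →
            ∑[ i < n ] f i ≤ (n ∸ 1) * c
∑≤[n∸1]*c {suc n} zero f {c} fw≡0 f≤c rewrite fw≡0 =
  ≤-trans (∑-mono-≤ (f≤c ∘ suc)) (≤-reflexive (∑-const n c))
∑≤[n∸1]*c {suc (suc n)} (suc w) f fw≡0 f≤c =
  +-mono-≤ (f≤c zero) (∑≤[n∸1]*c w (f ∘ suc) fw≡0 (f≤c ∘ suc))

sum-tabulate : ∀ {n} (f : Fin n → ℕ) → List.sum (tabulate f) ≡ ∑[ i < n ] f i
sum-tabulate {zero}  f = refl
sum-tabulate {suc n} f = cong (f zero +_) (sum-tabulate (f ∘ suc))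

sum-map-allFin : ∀ {n} (f : Fin n → ℕ) → List.sum (map f (allFinL n)) ≡ ∑[ i < n ] f i
sum-map-allFin f = trans (cong List.sum (map-tabulate id f)) (sum-tabulate f)

if-∧ : ∀ a b (x : ℕ) → (if a ∧ b then x else 0) ≡ (if a then (if b then x else 0) else 0)
if-∧ true  b x = refl
if-∧ false b x = refl

if-∨ : ∀ a b (x : ℕ) → (T a → T b → x ≡ 0) →
       (if a ∨ b then x else 0) ≡ (if a then x else 0) + (if b then x else 0)
if-∨ true  true  x both rewrite both _ _ = refl
if-∨ true  false x _ = sym (+-identityʳ x)
if-∨ false b     x _ = refl

if-∨∧∨ : ∀ a b c e (x : ℕ) → (T a → T c → ⊥) → (T b → T e → ⊥) →
         (if (a ∨ b) ∧ (c ∨ e) then x else 0) ≡ (if a ∧ e then x else 0) + (if c ∧ b then x else 0)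
if-∨∧∨ true  _     true  _     x a∧c _   = ⊥-elim (a∧c _ _)
if-∨∧∨ _     true  _     true  x _   b∧e = ⊥-elim (b∧e _ _)
if-∨∧∨ true  false false true  x _   _   = sym (+-identityʳ x)
if-∨∧∨ true  true  false false x _   _   = refl
if-∨∧∨ true  false false false x _   _   = refl
if-∨∧∨ false true  true  false x _   _   = refl
if-∨∧∨ false true  false false x _   _   = refl
if-∨∧∨ false false true  true  x _   _   = refl
if-∨∧∨ false false true  false x _   _   = refl
if-∨∧∨ false false false true  x _   _   = refl
if-∨∧∨ false false false false x _   _   = refl

≟⇒≡ : ∀ {n} {u w : Fin n} → T (does (u ≟ w)) → u ≡ w
≟⇒≡ {u = u} {w} u≟w with u ≟ w
... | yes u≡w = u≡w

∑∑-if-≟∧≟ : ∀ {n} (a b : Fin n) (x : Fin n → Fin n → ℕ) →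
            ∑[ u < n ] ∑[ v < n ] (if does (u ≟ a) ∧ does (v ≟ b) then x u v else 0) ≡ x a b
∑∑-if-≟∧≟ {n} a b x = trans (sum-cong-≗ row) (∑-if-≟ a (λ u → x u b))
  where
  row : ∀ u → ∑[ v < n ] (if does (u ≟ a) ∧ does (v ≟ b) then x u v else 0)
            ≡ (if does (u ≟ a) then x u b else 0)
  row u = begin
    ∑[ v < n ] (if does (u ≟ a) ∧ does (v ≟ b) then x u v else 0)
      ≡⟨ sum-cong-≗ (λ v → if-∧ (does (u ≟ a)) (does (v ≟ b)) (x u v)) ⟩
    ∑[ v < n ] (if does (u ≟ a) then (if does (v ≟ b) then x u v else 0) else 0)
      ≡⟨ ∑-if (does (u ≟ a)) (λ v → if does (v ≟ b) then x u v else 0) ⟩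
    (if does (u ≟ a) then ∑[ v < n ] (if does (v ≟ b) then x u v else 0) else 0)
      ≡⟨ cong (if does (u ≟ a) then_else 0) (∑-if-≟ b (x u)) ⟩
    (if does (u ≟ a) then x u b else 0)
      ∎
    where open ≡-Reasoning

-- Pairs u < v

ordered : ∀ {n} → (Fin n → Fin n → ℕ) → Fin n → Fin n → ℕ
ordered g u v = if does (toℕ u <? toℕ v) then g u v else 0

∑-pairs : ∀ {n} → (Fin n → Fin n → ℕ) → ℕ
∑-pairs {n} g = ∑[ u < n ] ∑[ v < n ] ordered g u v

ordered-< : ∀ {n} (g : Fin n → Fin n → ℕ) {u v} → toℕ u < toℕ v → ordered g u v ≡ g u v
ordered-< g {u} {v} u<v = cong (if_then g u v else 0) (dec-true (toℕ u <? toℕ v) u<v)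

ordered-≮ : ∀ {n} (g : Fin n → Fin n → ℕ) {u v} → ¬ toℕ u < toℕ v → ordered g u v ≡ 0
ordered-≮ g {u} {v} u≮v = cong (if_then g u v else 0) (dec-false (toℕ u <? toℕ v) u≮v)

ordered-diag : ∀ {n} (g : Fin n → Fin n → ℕ) u → ordered g u u ≡ 0
ordered-diag g u = ordered-≮ g (n≮n (toℕ u))

ordered+ordered-flip : ∀ {n} (g : Fin n → Fin n → ℕ) → (∀ u v → g u v ≡ g v u) → (∀ u → g u u ≡ 0) →
                       ∀ u v → ordered g u v + ordered g v u ≡ g u v
ordered+ordered-flip g g-sym g-diag u v with <-cmp (toℕ u) (toℕ v)
... | tri< u<v _ v≮u = trans (cong₂ _+_ (ordered-< g u<v) (ordered-≮ g v≮u)) (+-identityʳ (g u v))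
... | tri> u≮v _ v<u = trans (cong₂ _+_ (ordered-≮ g u≮v) (ordered-< g v<u)) (g-sym v u)
... | tri≈ _ u≡v _ with refl ← toℕ-injective u≡v =
  trans (cong₂ _+_ (ordered-diag g u) (ordered-diag g u)) (sym (g-diag u))

∑-pairs-mono : ∀ {n} {g h : Fin n → Fin n → ℕ} → (∀ u v → u ≢ v → g u v ≤ h u v) → ∑-pairs g ≤ ∑-pairs h
∑-pairs-mono {g = g} {h} g≤h = ∑-mono-≤ (λ u → ∑-mono-≤ (ordered-mono u))
  where
  ordered-mono : ∀ u v → ordered g u v ≤ ordered h u v
  ordered-mono u v with toℕ u <? toℕ v
  ... | yes u<v rewrite ordered-< g u<v | ordered-< h u<v = g≤h u v (λ { refl → n≮n _ u<v })
  ... | no u≮v rewrite ordered-≮ g u≮v = z≤n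

∑∑≡∑-pairs+∑-pairs : ∀ {n} (g : Fin n → Fin n → ℕ) → (∀ u v → g u v ≡ g v u) → (∀ u → g u u ≡ 0) →
                     ∑[ u < n ] ∑[ v < n ] g u v ≡ ∑-pairs g + ∑-pairs g
∑∑≡∑-pairs+∑-pairs {n} g g-sym g-diag = begin
  ∑[ u < n ] ∑[ v < n ] g u v
    ≡⟨ sum-cong-≗ (λ u → sum-cong-≗ (ordered+ordered-flip g g-sym g-diag u)) ⟨
  ∑[ u < n ] ∑[ v < n ] (ordered g u v + ordered g v u)
    ≡⟨ sum-cong-≗ (λ u → ∑-distrib-+ (ordered g u) (λ v → ordered g v u)) ⟩
  ∑[ u < n ] (∑[ v < n ] ordered g u v + ∑[ v < n ] ordered g v u)
    ≡⟨ ∑-distrib-+ (λ u → ∑[ v < n ] ordered g u v) (λ u → ∑[ v < n ] ordered g v u) ⟩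
  ∑-pairs g + ∑[ u < n ] ∑[ v < n ] ordered g v u
    ≡⟨ cong (∑-pairs g +_) (∑-comm (λ u v → ordered g v u)) ⟩
  ∑-pairs g + ∑-pairs g
    ∎
  where open ≡-Reasoning

-- The summand of pairSum is local to its definition, so its type is left to unification.
mutual
  pairSum≡∑-pairs : ∀ {n} (g : Fin n → Fin n → ℕ) → pairSum g ≡ ∑-pairs g
  pairSum≡∑-pairs {n} g = begin
    pairSum g
      ≡⟨ cong List.sum (map-cong (λ u → cong List.sum (map-cong (summand≡ordered g u) (allFinL n))) (allFinL n)) ⟩
    List.sum (map (λ u → List.sum (map (ordered g u) (allFinL n))) (allFinL n))
      ≡⟨ cong List.sum (map-cong (λ u → sum-map-allFin (ordered g u)) (allFinL n)) ⟩
    List.sum (map (λ u → ∑[ v < n ] ordered g u v) (allFinL n))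
      ≡⟨ sum-map-allFin (λ u → ∑[ v < n ] ordered g u v) ⟩
    ∑-pairs g
      ∎
    where open ≡-Reasoning

  summand≡ordered : ∀ {n} (g : Fin n → Fin n → ℕ) u v → _ ≡ ordered g u v
  summand≡ordered g u v with toℕ u <? toℕ v
  ... | yes u<v = sym (ordered-< g u<v)
  ... | no u≮v = sym (ordered-≮ g u≮v)

-- Subsets of colours

∣p∪q∣+∣p∩q∣≡∣p∣+∣q∣ : ∀ {k} (p q : Subset k) → ∣ p ∪ q ∣ + ∣ p ∩ q ∣ ≡ ∣ p ∣ + ∣ q ∣
∣p∪q∣+∣p∩q∣≡∣p∣+∣q∣ []          []          = refl
∣p∪q∣+∣p∩q∣≡∣p∣+∣q∣ (true ∷ p)  (true ∷ q)  = cong suc (begin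
  ∣ p ∪ q ∣ + suc ∣ p ∩ q ∣  ≡⟨ +-suc _ _ ⟩
  suc (∣ p ∪ q ∣ + ∣ p ∩ q ∣) ≡⟨ cong suc (∣p∪q∣+∣p∩q∣≡∣p∣+∣q∣ p q) ⟩
  suc (∣ p ∣ + ∣ q ∣)         ≡⟨ +-suc _ _ ⟨
  ∣ p ∣ + suc ∣ q ∣           ∎)
  where open ≡-Reasoning
∣p∪q∣+∣p∩q∣≡∣p∣+∣q∣ (true ∷ p)  (false ∷ q) = cong suc (∣p∪q∣+∣p∩q∣≡∣p∣+∣q∣ p q)
∣p∪q∣+∣p∩q∣≡∣p∣+∣q∣ (false ∷ p) (true ∷ q)  =
  trans (cong suc (∣p∪q∣+∣p∩q∣≡∣p∣+∣q∣ p q)) (sym (+-suc ∣ p ∣ ∣ q ∣))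
∣p∪q∣+∣p∩q∣≡∣p∣+∣q∣ (false ∷ p) (false ∷ q) = ∣p∪q∣+∣p∩q∣≡∣p∣+∣q∣ p q

∣p∪q∣≤∣p∣+∣q∣ : ∀ {k} (p q : Subset k) → ∣ p ∪ q ∣ ≤ ∣ p ∣ + ∣ q ∣
∣p∪q∣≤∣p∣+∣q∣ p q = subst (∣ p ∪ q ∣ ≤_) (∣p∪q∣+∣p∩q∣≡∣p∣+∣q∣ p q) (m≤m+n _ _)

∣p∩⋃f∣≤∑∣p∩f∣ : ∀ {k n} (p : Subset k) (f : Fin n → Subset k) →
                ∣ p ∩ ⋃ (tabulate f) ∣ ≤ ∑[ i < n ] ∣ p ∩ f i ∣
∣p∩⋃f∣≤∑∣p∩f∣ {k} {zero} p f = ≤-reflexive (trans (cong ∣_∣ (∩-zeroʳ p)) (∣⊥∣≡0 k))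
∣p∩⋃f∣≤∑∣p∩f∣ {n = suc n} p f rewrite ∩-distribˡ-∪ p (f zero) (⋃ (tabulate (f ∘ suc))) =
  ≤-trans (∣p∪q∣≤∣p∣+∣q∣ (p ∩ f zero) _) (+-monoʳ-≤ ∣ p ∩ f zero ∣ (∣p∩⋃f∣≤∑∣p∩f∣ p (f ∘ suc)))

∑∣f∣≤∣⋃f∣+∑-pairs∣f∩f∣ : ∀ {k n} (f : Fin n → Subset k) →
  ∑[ v < n ] ∣ f v ∣ ≤ ∣ ⋃ (tabulate f) ∣ + ∑-pairs (λ u v → ∣ f u ∩ f v ∣)
∑∣f∣≤∣⋃f∣+∑-pairs∣f∩f∣ {n = zero}  f = z≤n
∑∣f∣≤∣⋃f∣+∑-pairs∣f∩f∣ {k} {suc n} f = begin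
  ∣ f₀ ∣ + ∑[ v < n ] ∣ f′ v ∣                  ≤⟨ +-monoʳ-≤ ∣ f₀ ∣ (∑∣f∣≤∣⋃f∣+∑-pairs∣f∩f∣ f′) ⟩
  ∣ f₀ ∣ + (∣ U′ ∣ + Q′)                        ≡⟨ +-assoc ∣ f₀ ∣ ∣ U′ ∣ Q′ ⟨
  (∣ f₀ ∣ + ∣ U′ ∣) + Q′                        ≡⟨ cong (_+ Q′) (∣p∪q∣+∣p∩q∣≡∣p∣+∣q∣ f₀ U′) ⟨
  (∣ f₀ ∪ U′ ∣ + ∣ f₀ ∩ U′ ∣) + Q′              ≤⟨ +-monoˡ-≤ Q′ (+-monoʳ-≤ ∣ f₀ ∪ U′ ∣ (∣p∩⋃f∣≤∑∣p∩f∣ f₀ f′)) ⟩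
  (∣ f₀ ∪ U′ ∣ + ∑[ v < n ] ∣ f₀ ∩ f′ v ∣) + Q′ ≡⟨ +-assoc ∣ f₀ ∪ U′ ∣ _ Q′ ⟩
  ∣ f₀ ∪ U′ ∣ + (∑[ v < n ] ∣ f₀ ∩ f′ v ∣ + Q′) ∎
  where
  open ≤-Reasoning
  f₀ U′ : Subset k
  f′ : Fin n → Subset k
  Q′ : ℕ
  f₀ = f zero
  f′ = f ∘ suc
  U′ = ⋃ (tabulate f′)
  Q′ = ∑-pairs (λ u v → ∣ f′ u ∩ f′ v ∣)

∣p++q∣≡∣p∣+∣q∣ : ∀ {k l} (p : Subset k) (q : Subset l) → ∣ p ++ q ∣ ≡ ∣ p ∣ + ∣ q ∣
∣p++q∣≡∣p∣+∣q∣ []          q = refl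
∣p++q∣≡∣p∣+∣q∣ (true ∷ p)  q = cong suc (∣p++q∣≡∣p∣+∣q∣ p q)
∣p++q∣≡∣p∣+∣q∣ (false ∷ p) q = ∣p++q∣≡∣p∣+∣q∣ p q

∣replicate∣ : ∀ k b → ∣ replicate k b ∣ ≡ (if b then k else 0)
∣replicate∣ k true  = ∣⊤∣≡n k
∣replicate∣ k false = ∣⊥∣≡0 k

blocks : ∀ {n} (m : Fin n → ℕ) → ((i : Fin n) → Subset (m i)) → Subset (∑[ i < n ] m i)
blocks {zero}  m p = []
blocks {suc n} m p = p zero ++ blocks (m ∘ suc) (p ∘ suc)

∣blocks∣ : ∀ {n} (m : Fin n → ℕ) (p : (i : Fin n) → Subset (m i)) → ∣ blocks m p ∣ ≡ ∑[ i < n ] ∣ p i ∣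
∣blocks∣ {zero}  m p = refl
∣blocks∣ {suc n} m p =
  trans (∣p++q∣≡∣p∣+∣q∣ (p zero) _) (cong (∣ p zero ∣ +_) (∣blocks∣ (m ∘ suc) (p ∘ suc)))

blocks-∩ : ∀ {n} (m : Fin n → ℕ) (p q : (i : Fin n) → Subset (m i)) →
           blocks m p ∩ blocks m q ≡ blocks m (λ i → p i ∩ q i)
blocks-∩ {zero}  m p q = refl
blocks-∩ {suc n} m p q =
  trans (zipWith-++ _∧_ (p zero) _ (q zero) _) (cong (p zero ∩ q zero ++_) (blocks-∩ (m ∘ suc) (p ∘ suc) (q ∘ suc)))

blocks-cong : ∀ {n} (m : Fin n → ℕ) {p q : (i : Fin n) → Subset (m i)} → (∀ i → p i ≡ q i) → blocks m p ≡ blocks m q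
blocks-cong {zero}  m p≗q = refl
blocks-cong {suc n} m p≗q = cong₂ _++_ (p≗q zero) (blocks-cong (m ∘ suc) (p≗q ∘ suc))

select : ∀ {n} (m : Fin n → ℕ) → (Fin n → Bool) → Subset (∑[ i < n ] m i)
select m B = blocks m (λ i → replicate (m i) (B i))

∣select∣ : ∀ {n} (m : Fin n → ℕ) (B : Fin n → Bool) → ∣ select m B ∣ ≡ ∑[ i < n ] (if B i then m i else 0)
∣select∣ m B = trans (∣blocks∣ m _) (sum-cong-≗ (λ i → ∣replicate∣ (m i) (B i)))

select-∩ : ∀ {n} (m : Fin n → ℕ) (B C : Fin n → Bool) → select m B ∩ select m C ≡ select m (λ i → B i ∧ C i)
select-∩ m B C = trans (blocks-∩ m _ _) (blocks-cong m (λ i → zipWith-replicate _∧_ (B i) (C i)))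

select₂ : ∀ {n} (m : Fin n → Fin n → ℕ) → (Fin n → Fin n → Bool) → Subset (∑[ u < n ] ∑[ v < n ] m u v)
select₂ {n} m B = blocks (λ u → ∑[ v < n ] m u v) (λ u → select (m u) (B u))

∣select₂∣ : ∀ {n} (m : Fin n → Fin n → ℕ) (B : Fin n → Fin n → Bool) →
            ∣ select₂ m B ∣ ≡ ∑[ u < n ] ∑[ v < n ] (if B u v then m u v else 0)
∣select₂∣ {n} m B = trans (∣blocks∣ (λ u → ∑[ v < n ] m u v) (λ u → select (m u) (B u))) (sum-cong-≗ (λ u → ∣select∣ (m u) (B u)))

select₂-∩ : ∀ {n} (m : Fin n → Fin n → ℕ) (B C : Fin n → Fin n → Bool) →
            select₂ m B ∩ select₂ m C ≡ select₂ m (λ u v → B u v ∧ C u v)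
select₂-∩ {n} m B C =
  trans (blocks-∩ (λ u → ∑[ v < n ] m u v) _ _) (blocks-cong (λ u → ∑[ v < n ] m u v) (λ u → select-∩ (m u) (B u) (C u)))

-- Tone colourings

touches : ∀ {n} → Fin n → Fin n → Fin n → Bool
touches w u v = does (u ≟ w) ∨ does (v ≟ w)

load : ∀ {n} → (Fin n → Fin n → ℕ) → Fin n → ℕ
load {n} m w = ∑[ v < n ] (m w v + m v w)

∑∑-touches : ∀ {n} (m : Fin n → Fin n → ℕ) → (∀ w → m w w ≡ 0) →
             ∀ w → ∑[ u < n ] ∑[ v < n ] (if touches w u v then m u v else 0) ≡ load m w
∑∑-touches {n} m m-diag w = begin
  ∑[ u < n ] ∑[ v < n ] (if touches w u v then m u v else 0)
    ≡⟨ sum-cong-≗ (λ u → sum-cong-≗ (λ v → if-∨ (does (u ≟ w)) (does (v ≟ w)) (m u v) (diagonal u v))) ⟩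
  ∑[ u < n ] ∑[ v < n ] ((if does (u ≟ w) then m u v else 0) + (if does (v ≟ w) then m u v else 0))
    ≡⟨ sum-cong-≗ (λ u → ∑-distrib-+ (λ v → if does (u ≟ w) then m u v else 0) (λ v → if does (v ≟ w) then m u v else 0)) ⟩
  ∑[ u < n ] (∑[ v < n ] (if does (u ≟ w) then m u v else 0) + ∑[ v < n ] (if does (v ≟ w) then m u v else 0))
    ≡⟨ sum-cong-≗ (λ u → cong₂ _+_ (∑-if (does (u ≟ w)) (m u)) (∑-if-≟ w (m u))) ⟩
  ∑[ u < n ] ((if does (u ≟ w) then ∑[ v < n ] m u v else 0) + m u w)
    ≡⟨ ∑-distrib-+ (λ u → if does (u ≟ w) then ∑[ v < n ] m u v else 0) (λ u → m u w) ⟩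
  ∑[ u < n ] (if does (u ≟ w) then ∑[ v < n ] m u v else 0) + ∑[ u < n ] m u w
    ≡⟨ cong (_+ ∑[ u < n ] m u w) (∑-if-≟ w (λ u → ∑[ v < n ] m u v)) ⟩
  ∑[ v < n ] m w v + ∑[ v < n ] m v w
    ≡⟨ ∑-distrib-+ (m w) (λ v → m v w) ⟨
  load m w
    ∎
  where
  open ≡-Reasoning
  diagonal : ∀ u v → T (does (u ≟ w)) → T (does (v ≟ w)) → m u v ≡ 0
  diagonal u v u≟w v≟w with refl ← ≟⇒≡ {u = u} u≟w | refl ← ≟⇒≡ {u = v} v≟w = m-diag w

∑∑-touches-both : ∀ {n} (m : Fin n → Fin n → ℕ) {w w′} → w ≢ w′ →
  ∑[ u < n ] ∑[ v < n ] (if touches w u v ∧ touches w′ u v then m u v else 0) ≡ m w w′ + m w′ w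
∑∑-touches-both {n} m {w} {w′} w≢w′ = begin
  ∑[ u < n ] ∑[ v < n ] (if touches w u v ∧ touches w′ u v then m u v else 0)
    ≡⟨ sum-cong-≗ (λ u → sum-cong-≗ (λ v → if-∨∧∨ (does (u ≟ w)) (does (v ≟ w)) (does (u ≟ w′)) (does (v ≟ w′))
                                                  (m u v) (distinct u) (distinct v))) ⟩
  ∑[ u < n ] ∑[ v < n ] (at w w′ u v + at w′ w u v)
    ≡⟨ sum-cong-≗ (λ u → ∑-distrib-+ (at w w′ u) (at w′ w u)) ⟩
  ∑[ u < n ] (∑[ v < n ] at w w′ u v + ∑[ v < n ] at w′ w u v)
    ≡⟨ ∑-distrib-+ (λ u → ∑[ v < n ] at w w′ u v) (λ u → ∑[ v < n ] at w′ w u v) ⟩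
  ∑[ u < n ] ∑[ v < n ] at w w′ u v + ∑[ u < n ] ∑[ v < n ] at w′ w u v
    ≡⟨ cong₂ _+_ (∑∑-if-≟∧≟ w w′ m) (∑∑-if-≟∧≟ w′ w m) ⟩
  m w w′ + m w′ w
    ∎
  where
  open ≡-Reasoning
  at : Fin n → Fin n → Fin n → Fin n → ℕ
  at a b u v = if does (u ≟ a) ∧ does (v ≟ b) then m u v else 0
  distinct : ∀ x → T (does (x ≟ w)) → T (does (x ≟ w′)) → ⊥
  distinct x x≟w x≟w′ = w≢w′ (trans (sym (≟⇒≡ {u = x} x≟w)) (≟⇒≡ {u = x} x≟w′))

∑-if-≟∧≟-distinct : ∀ {n} (f : Fin n → ℕ) {w w′} → w ≢ w′ →
                    ∑[ v < n ] (if does (v ≟ w) ∧ does (v ≟ w′) then f v else 0) ≡ 0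
∑-if-≟∧≟-distinct {n} f {w} {w′} w≢w′ = begin
  ∑[ v < n ] (if does (v ≟ w) ∧ does (v ≟ w′) then f v else 0)
    ≡⟨ sum-cong-≗ (λ v → if-∧ (does (v ≟ w)) (does (v ≟ w′)) (f v)) ⟩
  ∑[ v < n ] (if does (v ≟ w) then (if does (v ≟ w′) then f v else 0) else 0)
    ≡⟨ ∑-if-≟ w (λ v → if does (v ≟ w′) then f v else 0) ⟩
  (if does (w ≟ w′) then f w else 0)
    ≡⟨ cong (if_then f w else 0) (dec-false (w ≟ w′) w≢w′) ⟩
  0 ∎
  where open ≡-Reasoning

sharedBlocks-colouring : ∀ {n} (d : Fin n → Fin n → ℕ) t (m : Fin n → Fin n → ℕ) →
  (∀ w → m w w ≡ 0) → (∀ w w′ → w ≢ w′ → m w w′ + m w′ w < d w w′) → (∀ w → load m w ≤ t) →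
  ToneColorable d t (∑[ u < n ] ∑[ v < n ] m u v + ∑[ w < n ] (t ∸ load m w))
sharedBlocks-colouring {n} d t m m-diag separated load≤t = colour , size , overlaps
  where
  fresh : Fin n → ℕ
  fresh w = t ∸ load m w

  colour : Fin n → Subset (∑[ u < n ] ∑[ v < n ] m u v + ∑[ w < n ] fresh w)
  colour w = select₂ m (touches w) ++ select fresh (λ v → does (v ≟ w))

  size : ∀ w → ∣ colour w ∣ ≡ t
  size w = begin
    ∣ colour w ∣
      ≡⟨ ∣p++q∣≡∣p∣+∣q∣ (select₂ m (touches w)) _ ⟩
    ∣ select₂ m (touches w) ∣ + ∣ select fresh (λ v → does (v ≟ w)) ∣
      ≡⟨ cong₂ _+_ (trans (∣select₂∣ m (touches w)) (∑∑-touches m m-diag w))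
                   (trans (∣select∣ fresh _) (∑-if-≟ w fresh)) ⟩
    load m w + (t ∸ load m w)
      ≡⟨ m+[n∸m]≡n (load≤t w) ⟩
    t ∎
    where open ≡-Reasoning

  overlaps : ∀ w w′ → w ≢ w′ → ∣ colour w ∩ colour w′ ∣ < d w w′
  overlaps w w′ w≢w′ = subst (_< d w w′) (sym shared) (separated w w′ w≢w′)
    where
    open ≡-Reasoning
    shared : ∣ colour w ∩ colour w′ ∣ ≡ m w w′ + m w′ w
    shared = begin
      ∣ colour w ∩ colour w′ ∣
        ≡⟨ cong ∣_∣ (zipWith-++ _∧_ (select₂ m (touches w)) _ (select₂ m (touches w′)) _) ⟩
      ∣ (select₂ m (touches w) ∩ select₂ m (touches w′)) ++
        (select fresh (λ v → does (v ≟ w)) ∩ select fresh (λ v → does (v ≟ w′))) ∣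
        ≡⟨ cong₂ (λ p q → ∣ p ++ q ∣) (select₂-∩ m (touches w) (touches w′)) (select-∩ fresh _ _) ⟩
      ∣ select₂ m (λ u v → touches w u v ∧ touches w′ u v) ++
        select fresh (λ v → does (v ≟ w) ∧ does (v ≟ w′)) ∣
        ≡⟨ ∣p++q∣≡∣p∣+∣q∣ (select₂ m (λ u v → touches w u v ∧ touches w′ u v)) _ ⟩
      ∣ select₂ m (λ u v → touches w u v ∧ touches w′ u v) ∣ +
        ∣ select fresh (λ v → does (v ≟ w) ∧ does (v ≟ w′)) ∣
        ≡⟨ cong₂ _+_ (trans (∣select₂∣ m _) (∑∑-touches-both m w≢w′))
                     (trans (∣select∣ fresh _) (∑-if-≟∧≟-distinct fresh w≢w′)) ⟩
      m w w′ + m w′ w + 0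
        ≡⟨ +-identityʳ _ ⟩
      m w w′ + m w′ w ∎

tone-lower-bound : ∀ {n} (d : Fin n → Fin n → ℕ) {t k} → ToneColorable d t k →
                   t * n ∸ pairSum (λ u v → d u v ∸ 1) ≤ k
tone-lower-bound {n} d {t} {k} (f , size , overlaps) = m≤n+o⇒m∸n≤o (t * n) (pairSum g) (begin
  t * n                                          ≡⟨ *-comm t n ⟩
  n * t                                          ≡⟨ ∑-const n t ⟨
  ∑[ v < n ] t                                   ≡⟨ sum-cong-≗ (sym ∘ size) ⟩
  ∑[ v < n ] ∣ f v ∣                             ≤⟨ ∑∣f∣≤∣⋃f∣+∑-pairs∣f∩f∣ f ⟩
  ∣ ⋃ (tabulate f) ∣ + ∑-pairs (λ u v → ∣ f u ∩ f v ∣)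
    ≤⟨ +-mono-≤ (∣p∣≤n (⋃ (tabulate f))) (∑-pairs-mono (λ u v u≢v → <⇒≤pred (overlaps u v u≢v))) ⟩
  k + ∑-pairs g                                  ≡⟨ cong (k +_) (pairSum≡∑-pairs g) ⟨
  k + pairSum g                                  ≡⟨ +-comm k (pairSum g) ⟩
  pairSum g + k                                  ∎)
  where
  open ≤-Reasoning
  g : Fin n → Fin n → ℕ
  g u v = d u v ∸ 1

private-colouring : ∀ {n} (d : Fin n → Fin n → ℕ) t → (∀ u v → u ≢ v → 0 < d u v) → ∃ (ToneColorable d t)
private-colouring {n} d t d>0 =
  _ , sharedBlocks-colouring d t (λ _ _ → 0) (λ _ → refl) d>0
        (λ _ → subst (_≤ t) (sym (sum-replicate-zero n)) z≤n)

extremal-colouring : ∀ {n} (d : Fin n → Fin n → ℕ) t →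
  (∀ u v → d u v ≡ d v u) → (∀ u → d u u ≡ 0) → (∀ u v → u ≢ v → 0 < d u v) →
  (∀ w → ∑[ v < n ] (d w v ∸ 1) ≤ t) →
  ToneColorable d t (t * n ∸ pairSum (λ u v → d u v ∸ 1))
extremal-colouring {n} d t d-sym d-diag d>0 budget =
  subst (ToneColorable d t) colours (sharedBlocks-colouring d t (ordered g) (ordered-diag g) separated load≤t)
  where
  g : Fin n → Fin n → ℕ
  g u v = d u v ∸ 1

  g-sym : ∀ u v → g u v ≡ g v u
  g-sym u v = cong (_∸ 1) (d-sym u v)

  g-diag : ∀ u → g u u ≡ 0
  g-diag u = cong (_∸ 1) (d-diag u)

  load≡ : ∀ w → load (ordered g) w ≡ ∑[ v < n ] g w v
  load≡ w = sum-cong-≗ (ordered+ordered-flip g g-sym g-diag w)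

  separated : ∀ w w′ → w ≢ w′ → ordered g w w′ + ordered g w′ w < d w w′
  separated w w′ w≢w′ rewrite ordered+ordered-flip g g-sym g-diag w w′ = ∸-monoʳ-< z<s (d>0 w w′ w≢w′)

  load≤t : ∀ w → load (ordered g) w ≤ t
  load≤t w = subst (_≤ t) (sym (load≡ w)) (budget w)

  P X : ℕ
  P = ∑-pairs g
  X = ∑[ w < n ] (t ∸ load (ordered g) w)

  colours : P + X ≡ t * n ∸ pairSum g
  colours = sym (begin
    t * n ∸ pairSum g                          ≡⟨ cong₂ _∸_ (*-comm t n) (pairSum≡∑-pairs g) ⟩
    n * t ∸ P                                  ≡⟨ cong (_∸ P) (∑-complement t (load (ordered g)) load≤t) ⟨
    X + ∑[ w < n ] load (ordered g) w ∸ P      ≡⟨ cong (λ s → X + s ∸ P) (sum-cong-≗ load≡) ⟩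
    X + ∑[ w < n ] ∑[ v < n ] g w v ∸ P        ≡⟨ cong (λ s → X + s ∸ P) (∑∑≡∑-pairs+∑-pairs g g-sym g-diag) ⟩
    X + (P + P) ∸ P                            ≡⟨ cong (_∸ P) (+-assoc X P P) ⟨
    X + P + P ∸ P                              ≡⟨ m+n∸n≡m (X + P) P ⟩
    X + P                                      ≡⟨ +-comm X P ⟩
    P + X                                      ∎)
    where open ≡-Reasoning

-- Graph distance

module _ {n} {G : Graph n} where

  snocWalk : ∀ {u v x k} → Walk G u v k → Adj G v x → Walk G u x (suc k)
  snocWalk here         a = step a here
  snocWalk (step b uv) a = step b (snocWalk uv a)

  reverseWalk : ∀ {u v k} → Walk G u v k → Walk G v u k
  reverseWalk here         = here
  reverseWalk (step a uv) = snocWalk (reverseWalk uv) (symAdj G a)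

  module _ {d : Fin n → Fin n → ℕ} (isDistance : IsDistance G d) where

    distance-sym : ∀ u v → d u v ≡ d v u
    distance-sym u v = ≤-antisym (proj₂ (isDistance u v) _ (reverseWalk (proj₁ (isDistance v u))))
                                 (proj₂ (isDistance v u) _ (reverseWalk (proj₁ (isDistance u v))))

    distance-diag : ∀ u → d u u ≡ 0
    distance-diag u = n≤0⇒n≡0 (proj₂ (isDistance u u) 0 here)

    distance-pos : ∀ u v → u ≢ v → 0 < d u v
    distance-pos u v u≢v with d u v | proj₁ (isDistance u v)
    ... | zero  | here = contradiction refl u≢v
    ... | suc _ | _    = s≤s z≤n

-- Decidability and the minimum

anyVector? : ∀ {a p} {A : Set a} → (∀ {q} {Q : A → Set q} → Decidable Q → Dec (∃ Q)) →
             ∀ {m} {P : Vector.Vector A m → Set p} → (∀ {f g} → f ≗ g → P f → P g) → Decidable P → Dec (∃ P)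
anyVector? ∃? {zero}  resp P? = map′ (_ ,_) (λ (f , Pf) → resp (λ ()) Pf) (P? (λ ()))
anyVector? ∃? {suc m} resp P? =
  map′ (λ (a , f , P[a∷f]) → a Vector.∷ f , P[a∷f])
       (λ (f , Pf) → Vector.head f , Vector.tail f , resp (λ { zero → refl ; (suc i) → refl }) Pf)
       (∃? (λ a → anyVector? ∃? (λ f≗g → resp (λ { zero → refl ; (suc i) → f≗g i })) (λ f → P? (a Vector.∷ f))))

toneColorable? : ∀ {n} (d : Fin n → Fin n → ℕ) t k → Dec (ToneColorable d t k)
toneColorable? d t k = anyVector? anySubset? respects isToneColoring?
  where
  isToneColoring? : Decidable (IsToneColoring d t k)
  isToneColoring? f = all? (λ v → ∣ f v ∣ ℕ.≟ t)
                ×-dec all? (λ u → all? (λ v → ¬? (u ≟ v) →-dec (∣ f u ∩ f v ∣ <? d u v)))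

  respects : ∀ {f g} → f ≗ g → IsToneColoring d t k f → IsToneColoring d t k g
  respects f≗g (size , overlaps) =
    (λ v → trans (cong ∣_∣ (sym (f≗g v))) (size v)) ,
    (λ u v u≢v → subst (_< d u v) (cong₂ (λ p q → ∣ p ∩ q ∣) (f≗g u) (f≗g v)) (overlaps u v u≢v))

∃-least : ∀ {p} {Q : ℕ → Set p} → Decidable Q → ∀ {N} → Q N → ∃ λ k → Q k × (∀ j → Q j → k ≤ j)
∃-least {Q = Q} Q? {N} QN = search 0 N (λ ()) (subst Q (sym (+-identityʳ N)) QN)
  where
  search : ∀ m f → (∀ {j} → j < m → ¬ Q j) → Q (f + m) → ∃ λ k → Q k × (∀ j → Q j → k ≤ j)
  search m zero    below Qm = m , Qm , λ j Qj → ≮⇒≥ (λ j<m → below j<m Qj)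
  search m (suc f) below Q[1+f+m] with Q? m
  ... | yes Qm = m , Qm , λ j Qj → ≮⇒≥ (λ j<m → below j<m Qj)
  ... | no ¬Qm = search (suc m) f below′ (subst Q (sym (+-suc f m)) Q[1+f+m])
    where
    below′ : ∀ {j} → j < suc m → ¬ Q j
    below′ (s≤s j≤m) with m≤n⇒m<n∨m≡n j≤m
    ... | inj₁ j<m  = below j<m
    ... | inj₂ refl = ¬Qm

theorem1p18 : ∀ (n : ℕ) (G : Graph n) (d : Fin n → Fin n → ℕ) (t : ℕ) →
    Connected G → IsDistance G d → 1 ≤ t →
    ∃[ τ ] (IsTau d t τ
      × (t * n ∸ pairSum (λ u v → d u v ∸ 1) ≤ τ)
      × (∀ (D : ℕ) → IsDiameter d D → (n ∸ 1) * (D ∸ 1) ≤ t →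
           τ ≡ t * n ∸ pairSum (λ u v → d u v ∸ 1)))
theorem1p18 n G d t _ isDistance _
  with ∃-least (toneColorable? d t) (proj₂ (private-colouring d t (distance-pos isDistance)))
... | τ , isTau@(colourable , minimal) = τ , isTau , tone-lower-bound d colourable , attained
  where
  attained : ∀ D → IsDiameter d D → (n ∸ 1) * (D ∸ 1) ≤ t → τ ≡ t * n ∸ pairSum (λ u v → d u v ∸ 1)
  attained D (d≤D , _) budget = ≤-antisym (minimal _ extremal) (tone-lower-bound d colourable)
    where
    load≤t : ∀ w → ∑[ v < n ] (d w v ∸ 1) ≤ t
    load≤t w = ≤-trans (∑≤[n∸1]*c w (λ v → d w v ∸ 1) (cong (_∸ 1) (distance-diag isDistance w))
                                   (λ v → ∸-monoˡ-≤ 1 (d≤D w v)))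
                       budget
    extremal : ToneColorable d t (t * n ∸ pairSum (λ u v → d u v ∸ 1))
    extremal = extremal-colouring d t (distance-sym isDistance) (distance-diag isDistance)
                                      (distance-pos isDistance) load≤t
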